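{- Let $n\ge1$ and $0\le i,j\le n-1$, and let $$u^n_j(i)=\sum_{k=n-j}^{n}s(n,k)\binom{k}{n-j}(n-1-i)^{k-(n-j)}$$ (with $0^0=1$). Then $$u^n_j(i)=n!\sum_{k\ge0}\frac{s(k,n-j)}{k!}\binom{n-i-1}{n-k}=n!\cdot\bigl[\text{coefficient of }x^{n-j}\text{ in }\tbinom{x+n-i-1}{n}\bigr],$$ where $\binom{x+n-i-1}{n}=\frac{(x+n-i-1)(x+n-i-2)\cdots(x-i)}{n!}$ is viewed as a polynomial in $x$.
   Context: $s(n,k)$ is the (signed) Stirling number of the first kind, defined by $x(x-1)\cdots(x-n+1)=\sum_{k\ge0}s(n,k)x^k$ (so $s(0,0)=1$). For any integer $b\ge2$, $u^n_j=(u^n_j(i))_{0\le i\le n-1}$ is a right eigenvector, with eigenvalue $b^{ -j}$, of the carries matrix $M(i,j)=b^{ -n}\sum_{l=0}^{j-\lfloor i/b\rfloor}(-1)^l\binom{n+1}{l}\binom{n-1-i+(j+1-l)b}{n}$, $0\le i,j\le n-1$ (the transition matrix of carries when adding $n$ numbers with uniform random base-$b$ digits). -}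

module Defs where

open import Data.Nat as ℕ using (ℕ; zero; suc; _∸_; _!; _^_)
open import Data.Nat.Properties using (_!≢0)
open import Data.Nat.Combinatorics using (_C_)
open import Data.Integer as ℤ using (ℤ; +_)
open import Data.Rational as ℚ using (ℚ; _/_)
open import Data.List using (List; []; _∷_; map)

-- signed Stirling numbers of the first kind:
-- x(x-1)...(x-n+1) = Σ_k s(n,k) x^k, via s(n+1,k+1) = s(n,k) - n s(n,k+1)
stirling1 : ℕ → ℕ → ℤ
stirling1 zero    zero    = + 1
stirling1 zero    (suc k) = + 0
stirling1 (suc n) zero    = + 0
stirling1 (suc n) (suc k) = stirling1 n k ℤ.- (+ n) ℤ.* stirling1 n (suc k)

sumFrom : ℕ → ℕ → (ℕ → ℤ) → ℤ
sumFrom a zero      f = + 0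
sumFrom a (suc len) f = f a ℤ.+ sumFrom (suc a) len f

sumFromℚ : ℕ → ℕ → (ℕ → ℚ) → ℚ
sumFromℚ a zero      f = ℚ.0ℚ
sumFromℚ a (suc len) f = f a ℚ.+ sumFromℚ (suc a) len f

u : ℕ → ℕ → ℕ → ℤ
u n j i = sumFrom (n ∸ j) (suc j) λ k →
  stirling1 n k ℤ.* (+ (k C (n ∸ j))) ℤ.* (+ ((n ∸ 1 ∸ i) ^ (k ∸ (n ∸ j))))

toℚ : ℤ → ℚ
toℚ z = z / 1

-- n! Σ_{k≥0} s(k,n-j)/k! · C(n-i-1, n-k); terms with k > n vanish
-- (binomial with negative lower index), so the sum runs over 0 ≤ k ≤ n.
middle : ℕ → ℕ → ℕ → ℚ
middle n j i = toℚ (+ (n !)) ℚ.* sumFromℚ 0 (suc n) λ k →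
  (stirling1 k (n ∸ j) / (k !)) {{k !≢0}} ℚ.* toℚ (+ ((n ∸ i ∸ 1) C (n ∸ k)))

-- polynomials over ℚ as coefficient lists, lowest degree first
Poly : Set
Poly = List ℚ

coeff : Poly → ℕ → ℚ
coeff []       _       = ℚ.0ℚ
coeff (a ∷ p)  zero    = a
coeff (a ∷ p)  (suc m) = coeff p m

addP : Poly → Poly → Poly
addP []      q       = q
addP p       []      = p
addP (a ∷ p) (b ∷ q) = (a ℚ.+ b) ∷ addP p q

scaleP : ℚ → Poly → Poly
scaleP c p = map (c ℚ.*_) p

-- multiply p by (x + c)
mulLin : ℚ → Poly → Poly
mulLin c p = addP (ℚ.0ℚ ∷ p) (scaleP c p)

fallingFrom : ℤ → ℕ → Poly
fallingFrom a zero    = ℚ.1ℚ ∷ []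
fallingFrom a (suc m) = mulLin (toℚ (a ℤ.- + m)) (fallingFrom a m)

-- C(x+n-i-1, n) = (x+n-i-1)(x+n-i-2)...(x-i)/n!  as a polynomial in x
binomPoly : ℕ → ℕ → Poly
binomPoly n i = scaleP ((+ 1 / (n !)) {{n !≢0}}) (fallingFrom (+ (n ∸ 1 ∸ i)) n)

module Submission where

-- Write a = n-1-i, m = n-j and let F(A,n,m) be the coefficient
-- of x^m in the falling product (x+A)(x+A-1)⋯(x+A-n+1).  All three
-- expressions of the theorem equal F(a,n,m) (the second one after division
-- by n!), and each equality is proved by induction against the recurrence
-- of F obtained by multiplying with one more linear factor:
--
--  * u^n_j(i) = Σ_k s(n,k) C(k,m) a^(k-m) is the x^m-coefficient of
--    Σ_k s(n,k) (x+a)^k = (x+a)(x+a-1)⋯; induction on n uses the Stirling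
--    recurrence together with (x+a)^(k+1) = (x+a)(x+a)^k.
--  * the middle sum Σ_k s(k,m) (n!/k!) C(a,n-k) is (Vandermonde) the
--    x^m-coefficient of n!·C(x+a,n); induction on a uses Pascal's rule and
--    the shift identity F(A+1,n+1) = F(A,n+1) + (n+1)F(A,n).
--  * the polynomial (fallingFrom A n) of Defs has coefficients F(A,n,-),
--    since both are built by the same multiplication by a linear factor.

module IntegerIdentities where

  open import Defs
  open import Function using (_∘_)
  open import Data.Nat as ℕ using (ℕ; zero; suc; _∸_; _!; _^_; _≤_; _<_; z≤n; s≤s)
  import Data.Nat.Properties as ℕP
  import Data.Nat.Tactic.RingSolver as ℕSolver
  open import Data.Nat.Combinatorics using (_C_; k>n⇒nCk≡0; nCk+nC[k+1]≡[n+1]C[k+1])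
  open import Data.Integer using (ℤ; +_; _+_; _*_; _-_; -_)
  import Data.Integer.Properties as ℤP
  open import Data.Integer.Tactic.RingSolver using (solve-∀)
  open import Relation.Binary.Definitions using (Tri; tri<; tri≈; tri>)
  open import Relation.Binary.PropositionalEquality
  open ≡-Reasoning

  sum-cong : ∀ a l {f g : ℕ → ℤ} → (∀ k → k < a ℕ.+ l → f k ≡ g k) →
             sumFrom a l f ≡ sumFrom a l g
  sum-cong a zero    eq = refl
  sum-cong a (suc l) eq = cong₂ _+_ (eq a (ℕP.m<m+n a (s≤s z≤n)))
    (sum-cong (suc a) l λ k k<a+l → eq k (subst (k <_) (sym (ℕP.+-suc a l)) k<a+l))

  sum-+ : ∀ a l (f g : ℕ → ℤ) →
          sumFrom a l (λ k → f k + g k) ≡ sumFrom a l f + sumFrom a l g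
  sum-+ a zero    f g = refl
  sum-+ a (suc l) f g = begin
    (f a + g a) + sumFrom (suc a) l (λ k → f k + g k)
      ≡⟨ cong (_+_ (f a + g a)) (sum-+ (suc a) l f g) ⟩
    (f a + g a) + (sumFrom (suc a) l f + sumFrom (suc a) l g)
      ≡⟨ interchange (f a) (g a) _ _ ⟩
    (f a + sumFrom (suc a) l f) + (g a + sumFrom (suc a) l g) ∎
    where
    interchange : ∀ x y X Y → (x + y) + (X + Y) ≡ (x + X) + (y + Y)
    interchange = solve-∀

  sum-scale : ∀ a l c (f : ℕ → ℤ) → sumFrom a l (λ k → c * f k) ≡ c * sumFrom a l f
  sum-scale a zero    c f = sym (ℤP.*-zeroʳ c)
  sum-scale a (suc l) c f =
    trans (cong (_+_ (c * f a)) (sum-scale (suc a) l c f)) (sym (ℤP.*-distribˡ-+ c (f a) _))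

  sum-snoc : ∀ a l (f : ℕ → ℤ) → sumFrom a (suc l) f ≡ sumFrom a l f + f (a ℕ.+ l)
  sum-snoc a zero    f = trans (ℤP.+-comm (f a) (+ 0)) (cong (λ b → + 0 + f b) (sym (ℕP.+-identityʳ a)))
  sum-snoc a (suc l) f = begin
    f a + sumFrom (suc a) (suc l) f
      ≡⟨ cong (_+_ (f a)) (sum-snoc (suc a) l f) ⟩
    f a + (sumFrom (suc a) l f + f (suc a ℕ.+ l))
      ≡⟨ sym (ℤP.+-assoc (f a) _ _) ⟩
    sumFrom a (suc l) f + f (suc a ℕ.+ l)
      ≡⟨ cong (λ b → sumFrom a (suc l) f + f b) (sym (ℕP.+-suc a l)) ⟩
    sumFrom a (suc l) f + f (a ℕ.+ suc l) ∎

  sum-shift : ∀ a l (f : ℕ → ℤ) → sumFrom (suc a) l f ≡ sumFrom a l (f ∘ suc)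
  sum-shift a zero    f = refl
  sum-shift a (suc l) f = cong (_+_ (f (suc a))) (sum-shift (suc a) l f)

  sum-dropZeros : ∀ a m l (f : ℕ → ℤ) → (∀ k → k < a ℕ.+ m → f k ≡ + 0) →
                  sumFrom a (m ℕ.+ l) f ≡ sumFrom (a ℕ.+ m) l f
  sum-dropZeros a zero    l f _  = cong (λ b → sumFrom b l f) (sym (ℕP.+-identityʳ a))
  sum-dropZeros a (suc m) l f f0 = begin
    f a + sumFrom (suc a) (m ℕ.+ l) f
      ≡⟨ cong₂ _+_ (f0 a (ℕP.m<m+n a (s≤s z≤n))) (sum-dropZeros (suc a) m l f f0′) ⟩
    + 0 + sumFrom (suc a ℕ.+ m) l f   ≡⟨ ℤP.+-identityˡ _ ⟩
    sumFrom (suc a ℕ.+ m) l f         ≡⟨ cong (λ b → sumFrom b l f) (sym (ℕP.+-suc a m)) ⟩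
    sumFrom (a ℕ.+ suc m) l f         ∎
    where
    f0′ : ∀ k → k < suc a ℕ.+ m → f k ≡ + 0
    f0′ k k< = f0 k (subst (k <_) (sym (ℕP.+-suc a m)) k<)

  stirling-above : ∀ {n k} → n < k → stirling1 n k ≡ + 0
  stirling-above {zero}  {suc k} _         = refl
  stirling-above {suc n} {suc k} (s≤s n<k)
    rewrite stirling-above n<k | stirling-above (ℕP.m<n⇒m<1+n n<k) | ℤP.*-zeroʳ (+ n) = refl

  n*stirling[n,0]≡0 : ∀ n → + n * stirling1 n 0 ≡ + 0
  n*stirling[n,0]≡0 zero    = refl
  n*stirling[n,0]≡0 (suc n) = ℤP.*-zeroʳ (+ suc n)

  -- Σ_{k≤n} s(n,k) g(k): the image of x(x-1)⋯(x-n+1) under the linear map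
  -- sending x^k to g(k).
  stirlingSum : ℕ → (ℕ → ℤ) → ℤ
  stirlingSum n g = sumFrom 0 (suc n) (λ k → stirling1 n k * g k)

  stirlingSum-cong : ∀ n {g h : ℕ → ℤ} → (∀ k → g k ≡ h k) → stirlingSum n g ≡ stirlingSum n h
  stirlingSum-cong n eq = sum-cong 0 (suc n) (λ k _ → cong (stirling1 n k *_) (eq k))

  stirlingSum-+ : ∀ n (g h : ℕ → ℤ) →
                  stirlingSum n (λ k → g k + h k) ≡ stirlingSum n g + stirlingSum n h
  stirlingSum-+ n g h =
    trans (sum-cong 0 (suc n) (λ k _ → ℤP.*-distribˡ-+ (stirling1 n k) (g k) (h k)))
          (sum-+ 0 (suc n) (λ k → stirling1 n k * g k) (λ k → stirling1 n k * h k))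

  stirlingSum-scale : ∀ n c (g : ℕ → ℤ) → stirlingSum n (λ k → c * g k) ≡ c * stirlingSum n g
  stirlingSum-scale n c g =
    trans (sum-cong 0 (suc n) (λ k _ → x∙yz≈y∙xz (stirling1 n k) c (g k))) (sum-scale 0 (suc n) c _)
    where
    x∙yz≈y∙xz : ∀ x y z → x * (y * z) ≡ y * (x * z)
    x∙yz≈y∙xz = solve-∀

  sum-rotate : ∀ n (h : ℕ → ℤ) →
               h 0 + sumFrom 0 (suc n) (h ∘ suc) ≡ sumFrom 0 (suc n) h + h (suc n)
  sum-rotate n h = trans (cong (_+_ (h 0)) (sym (sum-shift 0 (suc n) h))) (sum-snoc 0 (suc n) h)

  -- x^(n+1 falling) = x·x^(n falling) - n·x^(n falling), read through the linear map:
  -- the Stirling recurrence s(n+1,k+1) = s(n,k) - n s(n,k+1) in summed form.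
  stirlingSum-suc : ∀ n g → stirlingSum (suc n) g ≡ stirlingSum n (g ∘ suc) + (- + n) * stirlingSum n g
  stirlingSum-suc n g = begin
    + 0 * g 0 + sumFrom 1 (suc n) term
      ≡⟨ ℤP.+-identityˡ _ ⟩
    sumFrom 1 (suc n) term
      ≡⟨ sum-shift 0 (suc n) term ⟩
    sumFrom 0 (suc n) (term ∘ suc)
      ≡⟨ sum-cong 0 (suc n) (λ k _ → split (stirling1 n k) (+ n) (stirling1 n (suc k)) (g (suc k))) ⟩
    sumFrom 0 (suc n) (λ k → stirling1 n k * g (suc k) + (- + n) * h (suc k))
      ≡⟨ sum-+ 0 (suc n) (λ k → stirling1 n k * g (suc k)) (λ k → (- + n) * h (suc k)) ⟩
    stirlingSum n (g ∘ suc) + sumFrom 0 (suc n) (λ k → (- + n) * h (suc k))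
      ≡⟨ cong (_+_ (stirlingSum n (g ∘ suc))) (trans (sum-scale 0 (suc n) (- + n) (h ∘ suc)) boundary) ⟩
    stirlingSum n (g ∘ suc) + (- + n) * stirlingSum n g ∎
    where
    term h : ℕ → ℤ
    term k = stirling1 (suc n) k * g k
    h k    = stirling1 n k * g k
    split : ∀ x N y z → (x - N * y) * z ≡ x * z + (- N) * (y * z)
    split = solve-∀
    -- the boundary terms of the rotation are killed by the factor n
    boundary : (- + n) * sumFrom 0 (suc n) (h ∘ suc) ≡ (- + n) * stirlingSum n g
    boundary = begin
      (- + n) * sumFrom 0 (suc n) (h ∘ suc)
        ≡⟨ rearrange (+ n) (h 0) (sumFrom 0 (suc n) (h ∘ suc)) ⟩
      (- + n) * (h 0 + sumFrom 0 (suc n) (h ∘ suc)) + + n * h 0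
        ≡⟨ cong₂ (λ x y → (- + n) * x + y) (sum-rotate n h) (trans (sym (ℤP.*-assoc (+ n) _ _))
             (cong (_* g 0) (n*stirling[n,0]≡0 n))) ⟩
      (- + n) * (stirlingSum n g + h (suc n)) + + 0
        ≡⟨ cong (λ x → (- + n) * (stirlingSum n g + x * g (suc n)) + + 0) (stirling-above (ℕP.n<1+n n)) ⟩
      (- + n) * (stirlingSum n g + + 0 * g (suc n)) + + 0
        ≡⟨ dropZero (+ n) (stirlingSum n g) (g (suc n)) ⟩
      (- + n) * stirlingSum n g ∎
      where
      rearrange : ∀ N x S → (- N) * S ≡ (- N) * (x + S) + N * x
      rearrange = solve-∀
      dropZero : ∀ N S y → (- N) * (S + + 0 * y) + + 0 ≡ (- N) * S
      dropZero = solve-∀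

  -- Falling products.  fallingCoeff A n m is the coefficient of x^m in
  -- (x+A)(x+A-1)⋯(x+A-n+1), computed by multiplying with one linear factor at a time.
  fallingCoeff : ℤ → ℕ → ℕ → ℤ
  fallingCoeff A zero    zero    = + 1
  fallingCoeff A zero    (suc m) = + 0
  fallingCoeff A (suc n) zero    = (A - + n) * fallingCoeff A n zero
  fallingCoeff A (suc n) (suc m) = fallingCoeff A n m + (A - + n) * fallingCoeff A n (suc m)

  -- For A = 0 the falling product is x(x-1)⋯(x-n+1), so the coefficients are s(n,m).
  fallingCoeff-0 : ∀ n m → fallingCoeff (+ 0) n m ≡ stirling1 n m
  fallingCoeff-0 zero    zero    = refl
  fallingCoeff-0 zero    (suc m) = refl
  fallingCoeff-0 (suc n) zero    rewrite fallingCoeff-0 n zero =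
    trans (negate (+ n) (stirling1 n 0)) (cong -_ (n*stirling[n,0]≡0 n))
    where
    negate : ∀ N x → (+ 0 - N) * x ≡ - (N * x)
    negate = solve-∀
  fallingCoeff-0 (suc n) (suc m) rewrite fallingCoeff-0 n m | fallingCoeff-0 n (suc m) =
    negate (stirling1 n m) (+ n) (stirling1 n (suc m))
    where
    negate : ∀ x N y → x + (+ 0 - N) * y ≡ x - N * y
    negate = solve-∀

  -- Difference equation of the falling product in its argument:
  -- (y+1)y⋯(y-n+1) = y(y-1)⋯(y-n) + (n+1)·y(y-1)⋯(y-n+1)  with y = x+A.
  fallingCoeff-shift : ∀ A n m →
    fallingCoeff (A + + 1) (suc n) m ≡ fallingCoeff A (suc n) m + + suc n * fallingCoeff A n m
  fallingCoeff-shift A zero zero = ring A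
    where
    ring : ∀ A → (A + + 1 - + 0) * + 1 ≡ (A - + 0) * + 1 + + 1 * + 1
    ring = solve-∀
  fallingCoeff-shift A zero (suc zero) = ring A
    where
    ring : ∀ A → + 1 + (A + + 1 - + 0) * + 0 ≡ (+ 1 + (A - + 0) * + 0) + + 1 * + 0
    ring = solve-∀
  fallingCoeff-shift A zero (suc (suc m)) = ring A
    where
    ring : ∀ A → + 0 + (A + + 1 - + 0) * + 0 ≡ (+ 0 + (A - + 0) * + 0) + + 1 * + 0
    ring = solve-∀
  fallingCoeff-shift A (suc n) zero rewrite fallingCoeff-shift A n zero =
    ring A (+ n) (fallingCoeff A n zero)
    where
    ring : ∀ A N X → (A + + 1 - (+ 1 + N)) * ((A - N) * X + (+ 1 + N) * X)
                   ≡ (A - (+ 1 + N)) * ((A - N) * X) + (+ 1 + (+ 1 + N)) * ((A - N) * X)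
    ring = solve-∀
  fallingCoeff-shift A (suc n) (suc m) rewrite fallingCoeff-shift A n m | fallingCoeff-shift A n (suc m) =
    ring A (+ n) (fallingCoeff A (suc n) m) (fallingCoeff A n m) (fallingCoeff A n (suc m))
    where
    ring : ∀ A N Z W₀ W₁ →
           (Z + (+ 1 + N) * W₀) + (A + + 1 - (+ 1 + N)) * ((W₀ + (A - N) * W₁) + (+ 1 + N) * W₁)
         ≡ (Z + (A - (+ 1 + N)) * (W₀ + (A - N) * W₁)) + (+ 1 + (+ 1 + N)) * (W₀ + (A - N) * W₁)
    ring = solve-∀

  -- The form u: Σ_k s(n,k) C(k,m) a^(k-m).

  -- C(k,m) a^(k-m), the coefficient of x^m in (x+a)^k.
  powerCoeff : ℕ → ℕ → ℕ → ℕ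
  powerCoeff a k m = (k C m) ℕ.* a ^ (k ∸ m)

  -- (x+a)^(k+1) = (x+a)(x+a)^k, coefficientwise.
  powerCoeff-suc-zero : ∀ a k → powerCoeff a (suc k) 0 ≡ a ℕ.* powerCoeff a k 0
  powerCoeff-suc-zero a k = trans (ℕP.*-identityˡ _) (cong (a ℕ.*_) (sym (ℕP.*-identityˡ _)))

  powerCoeff-suc-suc : ∀ a k m →
    powerCoeff a (suc k) (suc m) ≡ powerCoeff a k m ℕ.+ a ℕ.* powerCoeff a k (suc m)
  powerCoeff-suc-suc a k m = begin
    (suc k C suc m) ℕ.* a ^ (k ∸ m)
      ≡⟨ cong (ℕ._* a ^ (k ∸ m)) (sym (nCk+nC[k+1]≡[n+1]C[k+1] k m)) ⟩
    (k C m ℕ.+ k C suc m) ℕ.* a ^ (k ∸ m)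
      ≡⟨ ℕP.*-distribʳ-+ (a ^ (k ∸ m)) (k C m) (k C suc m) ⟩
    powerCoeff a k m ℕ.+ (k C suc m) ℕ.* a ^ (k ∸ m)
      ≡⟨ cong (powerCoeff a k m ℕ.+_) (lowerPower (ℕP.<-cmp k m)) ⟩
    powerCoeff a k m ℕ.+ a ℕ.* powerCoeff a k (suc m) ∎
    where
    swapFactor : ∀ c a p → c ℕ.* (a ℕ.* p) ≡ a ℕ.* (c ℕ.* p)
    swapFactor = ℕSolver.solve-∀
    -- either C(k,m+1) = 0, or k - m = (k - (m+1)) + 1
    lowerPower : Tri (k < m) (k ≡ m) (m < k) → (k C suc m) ℕ.* a ^ (k ∸ m) ≡ a ℕ.* powerCoeff a k (suc m)
    lowerPower (tri> _ _ m<k) = trans (cong (λ e → (k C suc m) ℕ.* a ^ e) (ℕP.+-∸-assoc 1 m<k))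
                                      (swapFactor (k C suc m) a _)
    lowerPower (tri< k<m _ _) rewrite k>n⇒nCk≡0 (ℕP.m<n⇒m<1+n k<m) = sym (ℕP.*-zeroʳ a)
    lowerPower (tri≈ _ refl _) rewrite k>n⇒nCk≡0 (ℕP.n<1+n k) = sym (ℕP.*-zeroʳ a)

  uSum : ℕ → ℕ → ℕ → ℤ
  uSum a n m = stirlingSum n (λ k → + powerCoeff a k m)

  -- Σ_k s(n,k) (x+a)^k = (x+a)(x+a-1)⋯(x+a-n+1).
  uSum≡fallingCoeff : ∀ a n m → uSum a n m ≡ fallingCoeff (+ a) n m
  uSum≡fallingCoeff a zero    zero    = refl
  uSum≡fallingCoeff a zero    (suc m) = refl
  uSum≡fallingCoeff a (suc n) zero    = begin
    uSum a (suc n) 0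
      ≡⟨ stirlingSum-suc n _ ⟩
    stirlingSum n (λ k → + powerCoeff a (suc k) 0) + (- + n) * uSum a n 0
      ≡⟨ cong (_+ (- + n) * uSum a n 0) (trans (stirlingSum-cong n embed) (stirlingSum-scale n (+ a) _)) ⟩
    + a * uSum a n 0 + (- + n) * uSum a n 0
      ≡⟨ cong (λ x → + a * x + (- + n) * x) (uSum≡fallingCoeff a n 0) ⟩
    + a * F₀ + (- + n) * F₀
      ≡⟨ sym (ℤP.*-distribʳ-+ F₀ (+ a) (- + n)) ⟩
    fallingCoeff (+ a) (suc n) 0 ∎
    where
    F₀ = fallingCoeff (+ a) n 0
    embed : ∀ k → + powerCoeff a (suc k) 0 ≡ + a * + powerCoeff a k 0
    embed k = trans (cong +_ (powerCoeff-suc-zero a k)) (ℤP.pos-* a _)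
  uSum≡fallingCoeff a (suc n) (suc m) = begin
    uSum a (suc n) (suc m)
      ≡⟨ stirlingSum-suc n _ ⟩
    stirlingSum n (λ k → + powerCoeff a (suc k) (suc m)) + (- + n) * uSum a n (suc m)
      ≡⟨ cong (_+ (- + n) * uSum a n (suc m)) (trans (stirlingSum-cong n embed)
           (trans (stirlingSum-+ n _ _) (cong (_+_ (uSum a n m)) (stirlingSum-scale n (+ a) _)))) ⟩
    (uSum a n m + + a * uSum a n (suc m)) + (- + n) * uSum a n (suc m)
      ≡⟨ cong₂ (λ x y → (x + + a * y) + (- + n) * y)
           (uSum≡fallingCoeff a n m) (uSum≡fallingCoeff a n (suc m)) ⟩
    (fallingCoeff (+ a) n m + + a * F₁) + (- + n) * F₁
      ≡⟨ collect (fallingCoeff (+ a) n m) (+ a) (+ n) F₁ ⟩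
    fallingCoeff (+ a) (suc n) (suc m) ∎
    where
    F₁ = fallingCoeff (+ a) n (suc m)
    embed : ∀ k → + powerCoeff a (suc k) (suc m) ≡ + powerCoeff a k m + + a * + powerCoeff a k (suc m)
    embed k = trans (cong +_ (powerCoeff-suc-suc a k m))
                (trans (ℤP.pos-+ (powerCoeff a k m) _)
                  (cong (_+_ (+ powerCoeff a k m)) (ℤP.pos-* a (powerCoeff a k (suc m)))))
    collect : ∀ x A N y → (x + A * y) + (- N) * y ≡ x + (A - N) * y
    collect = solve-∀

  -- u^n_j(i) is uSum with a = n-1-i and m = n-j: the terms k < n-j vanish.
  u≡fallingCoeff : ∀ n j i → j ≤ n → u n j i ≡ fallingCoeff (+ (n ∸ 1 ∸ i)) n (n ∸ j)
  u≡fallingCoeff n j i j≤n = begin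
    u n j i
      ≡⟨ sum-cong (n ∸ j) (suc j) (λ k _ → sym (factor k)) ⟩
    sumFrom (n ∸ j) (suc j) summand
      ≡⟨ sym (sum-dropZeros 0 (n ∸ j) (suc j) summand vanish) ⟩
    sumFrom 0 (n ∸ j ℕ.+ suc j) summand
      ≡⟨ cong (λ l → sumFrom 0 l summand) length ⟩
    uSum a n (n ∸ j)
      ≡⟨ uSum≡fallingCoeff a n (n ∸ j) ⟩
    fallingCoeff (+ a) n (n ∸ j) ∎
    where
    a = n ∸ 1 ∸ i
    summand : ℕ → ℤ
    summand k = stirling1 n k * + powerCoeff a k (n ∸ j)
    factor : ∀ k → summand k ≡ stirling1 n k * + (k C (n ∸ j)) * + (a ^ (k ∸ (n ∸ j)))
    factor k = trans (cong (stirling1 n k *_) (ℤP.pos-* (k C (n ∸ j)) (a ^ (k ∸ (n ∸ j)))))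
                 (sym (ℤP.*-assoc (stirling1 n k) (+ (k C (n ∸ j))) (+ (a ^ (k ∸ (n ∸ j))))))
    vanish : ∀ k → k < n ∸ j → summand k ≡ + 0
    vanish k k<m rewrite k>n⇒nCk≡0 k<m = ℤP.*-zeroʳ (stirling1 n k)
    length : n ∸ j ℕ.+ suc j ≡ suc n
    length = trans (ℕP.+-suc (n ∸ j) j) (cong suc (ℕP.m∸n+n≡m j≤n))

  -- The middle form: Σ_k s(k,m) (n!/k!) C(a,n-k).

  risingFrom : ℕ → ℕ → ℕ
  risingFrom k zero    = 1
  risingFrom k (suc d) = suc (d ℕ.+ k) ℕ.* risingFrom k d

  risingFrom-! : ∀ k d → risingFrom k d ℕ.* k ! ≡ (d ℕ.+ k) !
  risingFrom-! k zero    = ℕP.+-identityʳ (k !)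
  risingFrom-! k (suc d) =
    trans (ℕP.*-assoc (suc (d ℕ.+ k)) (risingFrom k d) (k !)) (cong (suc (d ℕ.+ k) ℕ.*_) (risingFrom-! k d))

  factorialRatio : ℕ → ℕ → ℕ
  factorialRatio n k = risingFrom k (n ∸ k)

  factorialRatio-! : ∀ {n k} → k ≤ n → factorialRatio n k ℕ.* k ! ≡ n !
  factorialRatio-! {n} {k} k≤n = trans (risingFrom-! k (n ∸ k)) (cong _! (ℕP.m∸n+n≡m k≤n))

  factorialRatio-suc : ∀ {n k} → k ≤ n → factorialRatio (suc n) k ≡ suc n ℕ.* factorialRatio n k
  factorialRatio-suc {n} {k} k≤n rewrite ℕP.+-∸-assoc 1 k≤n | ℕP.m∸n+n≡m k≤n = refl

  middleWeight : ℕ → ℕ → ℕ → ℕ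
  middleWeight a n k = factorialRatio n k ℕ.* (a C (n ∸ k))

  middleWeight-top : ∀ a n → middleWeight a n n ≡ 1
  middleWeight-top a n rewrite ℕP.n∸n≡0 n = refl

  -- Pascal's rule in a, combined with n!/k! = n·(n-1)!/k!.
  middleWeight-step : ∀ a {n k} → k ≤ n →
    middleWeight (suc a) (suc n) k ≡ middleWeight a (suc n) k ℕ.+ suc n ℕ.* middleWeight a n k
  middleWeight-step a {n} {k} k≤n = begin
    factorialRatio (suc n) k ℕ.* (suc a C (suc n ∸ k))
      ≡⟨ cong₂ (λ r d → r ℕ.* (suc a C d)) (factorialRatio-suc k≤n) (ℕP.+-∸-assoc 1 k≤n) ⟩
    suc n ℕ.* R ℕ.* (suc a C suc (n ∸ k))
      ≡⟨ cong (suc n ℕ.* R ℕ.*_) (sym (nCk+nC[k+1]≡[n+1]C[k+1] a (n ∸ k))) ⟩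
    suc n ℕ.* R ℕ.* (a C (n ∸ k) ℕ.+ a C suc (n ∸ k))
      ≡⟨ distribute (suc n) R (a C (n ∸ k)) (a C suc (n ∸ k)) ⟩
    suc n ℕ.* R ℕ.* (a C suc (n ∸ k)) ℕ.+ suc n ℕ.* (R ℕ.* (a C (n ∸ k)))
      ≡⟨ cong₂ (λ r d → r ℕ.* (a C d) ℕ.+ suc n ℕ.* middleWeight a n k)
           (sym (factorialRatio-suc k≤n)) (sym (ℕP.+-∸-assoc 1 k≤n)) ⟩
    middleWeight a (suc n) k ℕ.+ suc n ℕ.* middleWeight a n k ∎
    where
    R = factorialRatio n k
    distribute : ∀ N R x y → N ℕ.* R ℕ.* (x ℕ.+ y) ≡ N ℕ.* R ℕ.* y ℕ.+ N ℕ.* (R ℕ.* x)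
    distribute = ℕSolver.solve-∀

  middleTerm : ℕ → ℕ → ℕ → ℕ → ℤ
  middleTerm a n m k = stirling1 k m * + middleWeight a n k

  middleSum : ℕ → ℕ → ℕ → ℤ
  middleSum a n m = sumFrom 0 (suc n) (middleTerm a n m)

  -- For a = 0 only the term k = n survives: C(0,n-k) = 0 for k < n.
  middleSum-0 : ∀ n m → middleSum 0 n m ≡ stirling1 n m
  middleSum-0 n m = begin
    sumFrom 0 (suc n) (middleTerm 0 n m)
      ≡⟨ cong (λ l → sumFrom 0 l (middleTerm 0 n m)) (ℕP.+-comm 1 n) ⟩
    sumFrom 0 (n ℕ.+ 1) (middleTerm 0 n m)
      ≡⟨ sum-dropZeros 0 n 1 (middleTerm 0 n m) vanish ⟩
    middleTerm 0 n m n + + 0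
      ≡⟨ ℤP.+-identityʳ _ ⟩
    stirling1 n m * + middleWeight 0 n n
      ≡⟨ cong (λ w → stirling1 n m * + w) (middleWeight-top 0 n) ⟩
    stirling1 n m * + 1
      ≡⟨ ℤP.*-identityʳ _ ⟩
    stirling1 n m ∎
    where
    vanish : ∀ k → k < n → middleTerm 0 n m k ≡ + 0
    vanish k k<n = begin
      stirling1 k m * + (factorialRatio n k ℕ.* (0 C (n ∸ k)))
        ≡⟨ cong (λ c → stirling1 k m * + (factorialRatio n k ℕ.* c))
             (k>n⇒nCk≡0 (ℕP.m<n⇒0<n∸m k<n)) ⟩
      stirling1 k m * + (factorialRatio n k ℕ.* 0)
        ≡⟨ cong (λ c → stirling1 k m * + c) (ℕP.*-zeroʳ (factorialRatio n k)) ⟩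
      stirling1 k m * + 0
        ≡⟨ ℤP.*-zeroʳ (stirling1 k m) ⟩
      + 0 ∎

  middleSum-step : ∀ a n m → middleSum (suc a) (suc n) m ≡ middleSum a (suc n) m + + suc n * middleSum a n m
  middleSum-step a n m = begin
    middleSum (suc a) (suc n) m
      ≡⟨ sum-snoc 0 (suc n) (middleTerm (suc a) (suc n) m) ⟩
    sumFrom 0 (suc n) (middleTerm (suc a) (suc n) m) + middleTerm (suc a) (suc n) m (suc n)
      ≡⟨ cong₂ _+_ (sum-cong 0 (suc n) (λ k k≤n → termStep k (ℕP.≤-pred k≤n))) top ⟩
    sumFrom 0 (suc n) (λ k → middleTerm a (suc n) m k + + suc n * middleTerm a n m k) + last
      ≡⟨ cong (_+ last) (trans (sum-+ 0 (suc n) (middleTerm a (suc n) m) (λ k → + suc n * middleTerm a n m k))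
           (cong (_+_ front) (sum-scale 0 (suc n) (+ suc n) (middleTerm a n m)))) ⟩
    (front + + suc n * middleSum a n m) + last
      ≡⟨ swap front (+ suc n * middleSum a n m) last ⟩
    (front + last) + + suc n * middleSum a n m
      ≡⟨ cong (_+ + suc n * middleSum a n m) (sym (sum-snoc 0 (suc n) (middleTerm a (suc n) m))) ⟩
    middleSum a (suc n) m + + suc n * middleSum a n m ∎
    where
    front = sumFrom 0 (suc n) (middleTerm a (suc n) m)
    last  = middleTerm a (suc n) m (suc n)
    top : middleTerm (suc a) (suc n) m (suc n) ≡ last
    top = cong (λ w → stirling1 (suc n) m * + w)
            (trans (middleWeight-top (suc a) (suc n)) (sym (middleWeight-top a (suc n))))
    termStep : ∀ k → k ≤ n →
               middleTerm (suc a) (suc n) m k ≡ middleTerm a (suc n) m k + + suc n * middleTerm a n m k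
    termStep k k≤n = begin
      stirling1 k m * + middleWeight (suc a) (suc n) k
        ≡⟨ cong (λ w → stirling1 k m * + w) (middleWeight-step a k≤n) ⟩
      stirling1 k m * + (middleWeight a (suc n) k ℕ.+ suc n ℕ.* middleWeight a n k)
        ≡⟨ cong (stirling1 k m *_) (trans (ℤP.pos-+ (middleWeight a (suc n) k) _)
             (cong (_+_ (+ middleWeight a (suc n) k)) (ℤP.pos-* (suc n) (middleWeight a n k)))) ⟩
      stirling1 k m * (+ middleWeight a (suc n) k + + suc n * + middleWeight a n k)
        ≡⟨ distrib (stirling1 k m) _ (+ suc n) _ ⟩
      middleTerm a (suc n) m k + + suc n * middleTerm a n m k ∎
      where
      distrib : ∀ s x N y → s * (x + N * y) ≡ s * x + N * (s * y)
      distrib = solve-∀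
    swap : ∀ x y z → (x + y) + z ≡ (x + z) + y
    swap = solve-∀

  -- Vandermonde: Σ_k C(x,k) C(a,n-k) = C(x+a,n), multiplied by n! and read coefficientwise.
  middleSum≡fallingCoeff : ∀ a n m → middleSum a n m ≡ fallingCoeff (+ a) n m
  middleSum≡fallingCoeff zero    n       m       = trans (middleSum-0 n m) (sym (fallingCoeff-0 n m))
  middleSum≡fallingCoeff (suc a) zero    zero    = refl
  middleSum≡fallingCoeff (suc a) zero    (suc m) = refl
  middleSum≡fallingCoeff (suc a) (suc n) m       = begin
    middleSum (suc a) (suc n) m
      ≡⟨ middleSum-step a n m ⟩
    middleSum a (suc n) m + + suc n * middleSum a n m
      ≡⟨ cong₂ (λ x y → x + + suc n * y)
           (middleSum≡fallingCoeff a (suc n) m) (middleSum≡fallingCoeff a n m) ⟩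
    fallingCoeff (+ a) (suc n) m + + suc n * fallingCoeff (+ a) n m
      ≡⟨ sym (fallingCoeff-shift (+ a) n m) ⟩
    fallingCoeff (+ a + + 1) (suc n) m
      ≡⟨ cong (λ A → fallingCoeff A (suc n) m) (ℤP.+-comm (+ a) (+ 1)) ⟩
    fallingCoeff (+ suc a) (suc n) m ∎

module RationalEmbedding where

  open import Defs
  open import Data.Nat as ℕ using (ℕ; zero; suc; _∸_; _!; _≤_; _<_; z≤n; s≤s)
  import Data.Nat.Properties as ℕP
  open import Data.Nat.Properties using (_!≢0)
  open import Data.Nat.Combinatorics using (_C_)
  open import Data.Integer as ℤ using (ℤ; +_)
  import Data.Integer.Properties as ℤP
  open import Data.Rational using (ℚ; _/_; _+_; _*_; 0ℚ; toℚᵘ)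
  import Data.Rational.Properties as ℚP
  open import Data.Rational.Unnormalised as ℚᵘ using (mkℚᵘ; *≡*; _≃_)
  import Data.Rational.Unnormalised.Properties as ℚᵘP
  open import Data.Integer.Tactic.RingSolver using (solve-∀)
  open import Data.List using ([]; _∷_)
  open import Algebra.Bundles using (CommutativeMonoid)
  open import Algebra.Properties.CommutativeSemigroup
    (CommutativeMonoid.commutativeSemigroup ℚP.*-1-commutativeMonoid) using (x∙yz≈y∙xz)
  open import Relation.Binary.PropositionalEquality
  open ≡-Reasoning
  open IntegerIdentities using (fallingCoeff; factorialRatio; factorialRatio-!; middleSum)

  -- The embedding z ↦ z/1 of ℤ into ℚ is a ring homomorphism; it is checked
  -- through the unnormalised representation, where z/1 is the fraction z over 1.

  toℚᵘ-toℚ : ∀ z → toℚᵘ (toℚ z) ≃ mkℚᵘ z 0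
  toℚᵘ-toℚ z = ℚP.toℚᵘ-fromℚᵘ (mkℚᵘ z 0)

  toℚ-+ : ∀ x y → toℚ (x ℤ.+ y) ≡ toℚ x + toℚ y
  toℚ-+ x y = ℚP.toℚᵘ-injective (ℚᵘP.≃-trans (toℚᵘ-toℚ (x ℤ.+ y)) (ℚᵘP.≃-trans sumOverOne
    (ℚᵘP.≃-sym (ℚᵘP.≃-trans (ℚP.toℚᵘ-homo-+ (toℚ x) (toℚ y))
                            (ℚᵘP.+-cong (toℚᵘ-toℚ x) (toℚᵘ-toℚ y))))))
    where
    sumOverOne : mkℚᵘ (x ℤ.+ y) 0 ≃ mkℚᵘ x 0 ℚᵘ.+ mkℚᵘ y 0
    sumOverOne = *≡* (cong₂ (λ p q → (p ℤ.+ q) ℤ.* + 1)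
                            (sym (ℤP.*-identityʳ x)) (sym (ℤP.*-identityʳ y)))

  toℚ-* : ∀ x y → toℚ (x ℤ.* y) ≡ toℚ x * toℚ y
  toℚ-* x y = ℚP.toℚᵘ-injective (ℚᵘP.≃-trans (toℚᵘ-toℚ (x ℤ.* y))
    (ℚᵘP.≃-sym (ℚᵘP.≃-trans (ℚP.toℚᵘ-homo-* (toℚ x) (toℚ y))
                            (ℚᵘP.*-cong (toℚᵘ-toℚ x) (toℚᵘ-toℚ y)))))

  toℚ-*-/ : ∀ z d .{{_ : ℕ.NonZero d}} → toℚ (+ d) * (z / d) ≡ toℚ z
  toℚ-*-/ z (suc d) = ℚP.toℚᵘ-injective (ℚᵘP.≃-trans (ℚP.toℚᵘ-homo-* (toℚ (+ suc d)) (z / suc d))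
    (ℚᵘP.≃-trans (ℚᵘP.*-cong (toℚᵘ-toℚ (+ suc d)) (ℚP.toℚᵘ-fromℚᵘ (mkℚᵘ z d)))
    (ℚᵘP.≃-trans (*≡* (cancel (+ suc d) z)) (ℚᵘP.≃-sym (toℚᵘ-toℚ z)))))
    where
    cancel : ∀ D z → (D ℤ.* z) ℤ.* + 1 ≡ z ℤ.* (+ 1 ℤ.* D)
    cancel = solve-∀

  cancel-denominator : ∀ z d .{{_ : ℕ.NonZero d}} q → toℚ (+ d) * ((z / d) * q) ≡ toℚ z * q
  cancel-denominator z d q = trans (sym (ℚP.*-assoc (toℚ (+ d)) (z / d) q)) (cong (_* q) (toℚ-*-/ z d))

  sumℚ-cong : ∀ a l {f g : ℕ → ℚ} → (∀ k → k < a ℕ.+ l → f k ≡ g k) →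
              sumFromℚ a l f ≡ sumFromℚ a l g
  sumℚ-cong a zero    eq = refl
  sumℚ-cong a (suc l) eq = cong₂ _+_ (eq a (ℕP.m<m+n a (s≤s z≤n)))
    (sumℚ-cong (suc a) l λ k k<a+l → eq k (subst (k <_) (sym (ℕP.+-suc a l)) k<a+l))

  sumℚ-scale : ∀ a l c (f : ℕ → ℚ) → c * sumFromℚ a l f ≡ sumFromℚ a l (λ k → c * f k)
  sumℚ-scale a zero    c f = ℚP.*-zeroʳ c
  sumℚ-scale a (suc l) c f =
    trans (ℚP.*-distribˡ-+ c (f a) _) (cong (_+_ (c * f a)) (sumℚ-scale (suc a) l c f))

  toℚ-sum : ∀ a l (f : ℕ → ℤ) → toℚ (sumFrom a l f) ≡ sumFromℚ a l (λ k → toℚ (f k))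
  toℚ-sum a zero    f = refl
  toℚ-sum a (suc l) f = trans (toℚ-+ (f a) _) (cong (_+_ (toℚ (f a))) (toℚ-sum (suc a) l f))

  middle≡middleSum : ∀ n a m →
    toℚ (+ (n !)) * sumFromℚ 0 (suc n) (λ k → (stirling1 k m / (k !)) {{k !≢0}} * toℚ (+ (a C (n ∸ k))))
      ≡ toℚ (middleSum a n m)
  middle≡middleSum n a m =
    trans (sumℚ-scale 0 (suc n) (toℚ (+ (n !))) _)
      (trans (sumℚ-cong 0 (suc n) (λ k k<1+n → term k (ℕP.≤-pred k<1+n)))
        (sym (toℚ-sum 0 (suc n) (IntegerIdentities.middleTerm a n m))))
    where
    term : ∀ k → k ≤ n → toℚ (+ (n !)) * ((stirling1 k m / (k !)) {{k !≢0}} * toℚ (+ (a C (n ∸ k))))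
                         ≡ toℚ (IntegerIdentities.middleTerm a n m k)
    term k k≤n = begin
      toℚ (+ (n !)) * (s/k! * binom)
        ≡⟨ cong (λ x → toℚ (+ x) * (s/k! * binom)) (sym (factorialRatio-! k≤n)) ⟩
      toℚ (+ (R ℕ.* k !)) * (s/k! * binom)
        ≡⟨ cong (_* (s/k! * binom)) (trans (cong toℚ (ℤP.pos-* R (k !))) (toℚ-* (+ R) (+ (k !)))) ⟩
      (toℚ (+ R) * toℚ (+ (k !))) * (s/k! * binom)
        ≡⟨ ℚP.*-assoc (toℚ (+ R)) _ _ ⟩
      toℚ (+ R) * (toℚ (+ (k !)) * (s/k! * binom))
        ≡⟨ cong (toℚ (+ R) *_) (cancel-denominator (stirling1 k m) (k !) {{k !≢0}} binom) ⟩
      toℚ (+ R) * (toℚ (stirling1 k m) * binom)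
        ≡⟨ x∙yz≈y∙xz (toℚ (+ R)) (toℚ (stirling1 k m)) binom ⟩
      toℚ (stirling1 k m) * (toℚ (+ R) * binom)
        ≡⟨ sym (trans (toℚ-* (stirling1 k m) _)
             (cong (toℚ (stirling1 k m) *_)
               (trans (cong toℚ (ℤP.pos-* R (a C (n ∸ k)))) (toℚ-* (+ R) _)))) ⟩
      toℚ (IntegerIdentities.middleTerm a n m k) ∎
      where
      R = factorialRatio n k
      s/k! = (stirling1 k m / (k !)) {{k !≢0}}
      binom = toℚ (+ (a C (n ∸ k)))

  coeff-addP : ∀ p q m → coeff (addP p q) m ≡ coeff p m + coeff q m
  coeff-addP []      q       m       = sym (ℚP.+-identityˡ _)
  coeff-addP (a ∷ p) []      m       = sym (ℚP.+-identityʳ _)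
  coeff-addP (a ∷ p) (b ∷ q) zero    = refl
  coeff-addP (a ∷ p) (b ∷ q) (suc m) = coeff-addP p q m

  coeff-scaleP : ∀ c p m → coeff (scaleP c p) m ≡ c * coeff p m
  coeff-scaleP c []      m       = sym (ℚP.*-zeroʳ c)
  coeff-scaleP c (a ∷ p) zero    = refl
  coeff-scaleP c (a ∷ p) (suc m) = coeff-scaleP c p m

  -- fallingFrom A n is built by the same recurrence that defines fallingCoeff.
  coeff-fallingFrom : ∀ A n m → coeff (fallingFrom A n) m ≡ toℚ (fallingCoeff A n m)
  coeff-fallingFrom A zero    zero    = refl
  coeff-fallingFrom A zero    (suc m) = refl
  coeff-fallingFrom A (suc n) zero    = begin
    coeff (addP (0ℚ ∷ p) (scaleP c p)) zero ≡⟨ coeff-addP (0ℚ ∷ p) (scaleP c p) zero ⟩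
    0ℚ + coeff (scaleP c p) zero           ≡⟨ ℚP.+-identityˡ _ ⟩
    coeff (scaleP c p) zero                ≡⟨ coeff-scaleP c p zero ⟩
    c * coeff p zero                       ≡⟨ cong (c *_) (coeff-fallingFrom A n zero) ⟩
    c * toℚ (fallingCoeff A n zero)        ≡⟨ sym (toℚ-* (A ℤ.- + n) (fallingCoeff A n zero)) ⟩
    toℚ (fallingCoeff A (suc n) zero)      ∎
    where
    p = fallingFrom A n
    c = toℚ (A ℤ.- + n)
  coeff-fallingFrom A (suc n) (suc m) = begin
    coeff (addP (0ℚ ∷ p) (scaleP c p)) (suc m)
      ≡⟨ coeff-addP (0ℚ ∷ p) (scaleP c p) (suc m) ⟩
    coeff p m + coeff (scaleP c p) (suc m)
      ≡⟨ cong₂ _+_ (coeff-fallingFrom A n m) (coeff-scaleP c p (suc m)) ⟩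
    toℚ (fallingCoeff A n m) + c * coeff p (suc m)
      ≡⟨ cong (λ x → toℚ (fallingCoeff A n m) + c * x) (coeff-fallingFrom A n (suc m)) ⟩
    toℚ (fallingCoeff A n m) + c * toℚ (fallingCoeff A n (suc m))
      ≡⟨ sym (trans (toℚ-+ (fallingCoeff A n m) ((A ℤ.- + n) ℤ.* fallingCoeff A n (suc m)))
             (cong (_+_ (toℚ (fallingCoeff A n m))) (toℚ-* (A ℤ.- + n) (fallingCoeff A n (suc m))))) ⟩
    toℚ (fallingCoeff A (suc n) (suc m)) ∎
    where
    p = fallingFrom A n
    c = toℚ (A ℤ.- + n)

  factorial*coeff-binomial : ∀ A n m →
    toℚ (+ (n !)) * coeff (scaleP ((+ 1 / (n !)) {{n !≢0}}) (fallingFrom A n)) m ≡ toℚ (fallingCoeff A n m)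
  factorial*coeff-binomial A n m = begin
    toℚ (+ (n !)) * coeff (scaleP 1/n! (fallingFrom A n)) m
      ≡⟨ cong (toℚ (+ (n !)) *_) (coeff-scaleP 1/n! (fallingFrom A n) m) ⟩
    toℚ (+ (n !)) * (1/n! * coeff (fallingFrom A n) m)
      ≡⟨ cancel-denominator (+ 1) (n !) {{n !≢0}} _ ⟩
    toℚ (+ 1) * coeff (fallingFrom A n) m
      ≡⟨ ℚP.*-identityˡ _ ⟩
    coeff (fallingFrom A n) m
      ≡⟨ coeff-fallingFrom A n m ⟩
    toℚ (fallingCoeff A n m) ∎
    where
    1/n! = (+ 1 / (n !)) {{n !≢0}}

open import Defs
open import Data.Nat using (ℕ; _≤_; _<_; _∸_; _!)
open import Data.Nat.Properties using (<⇒≤; ∸-+-assoc; +-comm)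
open import Data.Integer using (+_)
open import Data.Rational using (_*_)
open import Data.Product using (_×_; _,_)
open import Relation.Binary.PropositionalEquality using (_≡_; trans; sym; cong)
open IntegerIdentities using (fallingCoeff; u≡fallingCoeff; middleSum≡fallingCoeff)
open RationalEmbedding using (middle≡middleSum; factorial*coeff-binomial)

n∸i∸1≡n∸1∸i : ∀ n i → n ∸ i ∸ 1 ≡ n ∸ 1 ∸ i
n∸i∸1≡n∸1∸i n i = trans (∸-+-assoc n i 1) (trans (cong (n ∸_) (+-comm i 1)) (sym (∸-+-assoc n 1 i)))

theorem3p1 : (n i j : ℕ) → 1 ≤ n → i < n → j < n →
    (toℚ (u n j i) ≡ middle n j i)
    × (middle n j i ≡ toℚ (+ (n !)) * coeff (binomPoly n i) (n ∸ j))
theorem3p1 n i j _ _ j<n = trans (cong toℚ u≡F) (sym middle≡F) , trans middle≡F (sym binomial≡F)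
  where
  F = fallingCoeff (+ (n ∸ 1 ∸ i)) n (n ∸ j)
  u≡F : u n j i ≡ F
  u≡F = u≡fallingCoeff n j i (<⇒≤ j<n)
  middle≡F : middle n j i ≡ toℚ F
  middle≡F = trans (middle≡middleSum n (n ∸ i ∸ 1) (n ∸ j))
    (cong toℚ (trans (middleSum≡fallingCoeff (n ∸ i ∸ 1) n (n ∸ j))
                     (cong (λ a → fallingCoeff (+ a) n (n ∸ j)) (n∸i∸1≡n∸1∸i n i))))
  binomial≡F : toℚ (+ (n !)) * coeff (binomPoly n i) (n ∸ j) ≡ toℚ F
  binomial≡F = factorial*coeff-binomial (+ (n ∸ 1 ∸ i)) n (n ∸ j)
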